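{- A morphism $(h,k):(\mathbf{B}_1,\mathbf{D}_1,\phi_1)\to(\mathbf{B}_2,\mathbf{D}_2,\phi_2)$ in the category $\mathfrak{T}$ is an isomorphism in $\mathfrak{T}$ if and only if: $h$ is an isomorphism from $\mathbf{B}_1$ onto $\mathbf{B}_2$; $k$ is an isomorphism from $\mathbf{D}_1$ onto $\mathbf{D}_2$; and $k(\phi_1(a))=\phi_2(h(a))$ for all $a\in B_1$.
   Context: A residuated lattice is an algebra $(A,\ast,\to,\vee,\wedge,\top)$ with $(A,\ast,\top)$ a commutative monoid, $(A,\vee,\wedge)$ a lattice with top $\top$, and $x\ast y\le z$ iff $x\le y\to z$. An i-filter of a residuated lattice $\mathbf{D}$ is a subset $F$ with $\top\in F$ such that $x,x\to y\in F$ imply $y\in F$; $\mathcal{F}_i(\mathbf{D})$ is the bounded lattice of i-filters under inclusion (bottom $\{\top\}$, top $D$). The category $\mathfrak{T}$ has as objects triples $(\mathbf{B},\mathbf{D},\phi)$ with $\mathbf{B}$ a Boolean algebra, $\mathbf{D}$ a residuated lattice and $\phi:\mathbf{B}\to\mathcal{F}_i(\mathbf{D})$ a lattice homomorphism preserving bottom and top; a morphism $(\mathbf{B}_1,\mathbf{D}_1,\phi_1)\to(\mathbf{B}_2,\mathbf{D}_2,\phi_2)$ is a pair $(h,k)$ with $h:\mathbf{B}_1\to\mathbf{B}_2$ a Boolean algebra homomorphism, $k:\mathbf{D}_1\to\mathbf{D}_2$ a residuated lattice homomorphism, and $k(\phi_1(a))\subseteq\phi_2(h(a))$ for all $a\in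 B_1$; composition is componentwise and identities are $(id_{\mathbf{B}},id_{\mathbf{D}})$. -}

module Defs where

open import Level using (0ℓ)
open import Data.Product using (Σ; Σ-syntax; _×_; _,_; proj₁)
open import Data.Unit using (⊤)
open import Function using (_∘_)
open import Function.Definitions using (Bijective)
open import Relation.Binary.PropositionalEquality using (_≡_)
open import Relation.Unary using (Pred; _⊆_; _≐_; _∈_)
import Algebra.Structures as AS
import Algebra.Lattice.Structures as LS

record BooleanAlgebra : Set₁ where
  field
    Carrier : Set
    _∨_ _∧_ : Carrier → Carrier → Carrier
    ¬_      : Carrier → Carrier
    top bot : Carrier
    isBooleanAlgebra : LS.IsBooleanAlgebra {A = Carrier} _≡_ _∨_ _∧_ ¬_ top bot

record IsBAHom (B₁ B₂ : BooleanAlgebra) (h : BooleanAlgebra.Carrier B₁ → BooleanAlgebra.Carrier B₂) : Set where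
  private
    module B₁ = BooleanAlgebra B₁
    module B₂ = BooleanAlgebra B₂
  field
    ∨-hom   : ∀ x y → h (x B₁.∨ y) ≡ h x B₂.∨ h y
    ∧-hom   : ∀ x y → h (x B₁.∧ y) ≡ h x B₂.∧ h y
    ¬-hom   : ∀ x → h (B₁.¬ x) ≡ B₂.¬ (h x)
    top-hom : h B₁.top ≡ B₂.top
    bot-hom : h B₁.bot ≡ B₂.bot

record IsBAIso (B₁ B₂ : BooleanAlgebra) (h : BooleanAlgebra.Carrier B₁ → BooleanAlgebra.Carrier B₂) : Set where
  field
    isHom     : IsBAHom B₁ B₂ h
    bijective : Bijective _≡_ _≡_ h

record ResiduatedLattice : Set₁ where
  field
    Carrier : Set
    _*_ _⇒_ _∨_ _∧_ : Carrier → Carrier → Carrier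
    top : Carrier
    isCommutativeMonoid : AS.IsCommutativeMonoid {A = Carrier} _≡_ _*_ top
    isLattice           : LS.IsLattice {A = Carrier} _≡_ _∨_ _∧_

  _≤_ : Carrier → Carrier → Set
  x ≤ y = x ∧ y ≡ x

  field
    top-max     : ∀ x → x ≤ top
    residuation : ∀ x y z → ((x * y) ≤ z → x ≤ (y ⇒ z)) × (x ≤ (y ⇒ z) → (x * y) ≤ z)

record IsRLHom (D₁ D₂ : ResiduatedLattice) (k : ResiduatedLattice.Carrier D₁ → ResiduatedLattice.Carrier D₂) : Set where
  private
    module D₁ = ResiduatedLattice D₁
    module D₂ = ResiduatedLattice D₂
  field
    *-hom   : ∀ x y → k (x D₁.* y) ≡ k x D₂.* k y
    ⇒-hom   : ∀ x y → k (x D₁.⇒ y) ≡ k x D₂.⇒ k y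
    ∨-hom   : ∀ x y → k (x D₁.∨ y) ≡ k x D₂.∨ k y
    ∧-hom   : ∀ x y → k (x D₁.∧ y) ≡ k x D₂.∧ k y
    top-hom : k D₁.top ≡ D₂.top

record IsRLIso (D₁ D₂ : ResiduatedLattice) (k : ResiduatedLattice.Carrier D₁ → ResiduatedLattice.Carrier D₂) : Set where
  field
    isHom     : IsRLHom D₁ D₂ k
    bijective : Bijective _≡_ _≡_ k

record IsIFilter (D : ResiduatedLattice) (F : Pred (ResiduatedLattice.Carrier D) 0ℓ) : Set where
  open ResiduatedLattice D
  field
    top-in : top ∈ F
    mp     : ∀ x y → x ∈ F → (x ⇒ y) ∈ F → y ∈ F

IFilter : ResiduatedLattice → Set₁
IFilter D = Σ (Pred (ResiduatedLattice.Carrier D) 0ℓ) (IsIFilter D)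

bottomFilter : (D : ResiduatedLattice) → Pred (ResiduatedLattice.Carrier D) 0ℓ
bottomFilter D x = x ≡ ResiduatedLattice.top D

topFilter : (D : ResiduatedLattice) → Pred (ResiduatedLattice.Carrier D) 0ℓ
topFilter D x = ⊤

IsJoin : (D : ResiduatedLattice) → (F G H : IFilter D) → Set₁
IsJoin D (F , _) (G , _) (H , _) =
  F ⊆ H × G ⊆ H × (∀ (K : IFilter D) → F ⊆ proj₁ K → G ⊆ proj₁ K → H ⊆ proj₁ K)

IsMeet : (D : ResiduatedLattice) → (F G H : IFilter D) → Set₁
IsMeet D (F , _) (G , _) (H , _) =
  H ⊆ F × H ⊆ G × (∀ (K : IFilter D) → proj₁ K ⊆ F → proj₁ K ⊆ G → proj₁ K ⊆ H)

record IsBoundedLatticeHom (B : BooleanAlgebra) (D : ResiduatedLattice)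
                           (φ : BooleanAlgebra.Carrier B → IFilter D) : Set₁ where
  open BooleanAlgebra B
  field
    ∨-hom   : ∀ a b → IsJoin D (φ a) (φ b) (φ (a ∨ b))
    ∧-hom   : ∀ a b → IsMeet D (φ a) (φ b) (φ (a ∧ b))
    bot-hom : proj₁ (φ bot) ≐ bottomFilter D
    top-hom : proj₁ (φ top) ≐ topFilter D

record TObj : Set₂ where
  field
    B   : BooleanAlgebra
    D   : ResiduatedLattice
    φ   : BooleanAlgebra.Carrier B → IFilter D
    φ-hom : IsBoundedLatticeHom B D φ

Image : {A C : Set} → (A → C) → Pred A 0ℓ → Pred C 0ℓ
Image {A} k F y = Σ[ x ∈ A ] (x ∈ F × k x ≡ y)

record TMor (X Y : TObj) : Set where
  private
    module X = TObj X
    module Y = TObj Y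
  field
    h : BooleanAlgebra.Carrier X.B → BooleanAlgebra.Carrier Y.B
    k : ResiduatedLattice.Carrier X.D → ResiduatedLattice.Carrier Y.D
    h-hom : IsBAHom X.B Y.B h
    k-hom : IsRLHom X.D Y.D k
    compat : ∀ a → Image k (proj₁ (X.φ a)) ⊆ proj₁ (Y.φ (h a))

IsTIso : ∀ {X Y} → TMor X Y → Set
IsTIso {X} {Y} f =
  Σ[ g ∈ TMor Y X ]
    ((∀ a → TMor.h g (TMor.h f a) ≡ a) × (∀ x → TMor.k g (TMor.k f x) ≡ x)) ×
    ((∀ b → TMor.h f (TMor.h g b) ≡ b) × (∀ y → TMor.k f (TMor.k g y) ≡ y))

-- An isomorphism in 𝔗 is a pair of mutually inverse morphisms, so h and k are
-- bijective homomorphisms, and the compatibility condition of the inverse,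
-- k⁻¹(φ₂(h a)) ⊆ φ₁(a), is exactly the reverse inclusion φ₂(h a) ⊆ k(φ₁(a)).
-- Conversely, the inverse of a bijective homomorphism is a homomorphism, and
-- the equality k(φ₁(a)) = φ₂(h a) at a = h⁻¹ b gives the compatibility of
-- (h⁻¹, k⁻¹).
module Submission where

open import Defs
open import Data.Product using (_×_; _,_; proj₁; proj₂)
open import Function using (_∘_)
open import Function.Bundles using (_⇔_; mk⇔; mk⤖; Inverse)
open import Function.Definitions using (Bijective; StrictlyInverseˡ; StrictlyInverseʳ)
open import Function.Consequences.Propositional
  using (inverseᵇ⇒bijective; strictlyInverseˡ⇒inverseˡ; strictlyInverseʳ⇒inverseʳ)
open import Function.Properties.Bijection using (⤖⇒↔)
open import Relation.Unary using (Pred; _⊆_; _≐_)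
open import Relation.Binary.PropositionalEquality
open import Level using (0ℓ)
open import Algebra.Core using (Op₁; Op₂)

module _ {A C : Set} {f : A → C} {f⁻¹ : C → A} where

  strictlyInverse⇒bijective : StrictlyInverseˡ _≡_ f f⁻¹ → StrictlyInverseʳ _≡_ f f⁻¹ →
                              Bijective _≡_ _≡_ f
  strictlyInverse⇒bijective invˡ invʳ =
    inverseᵇ⇒bijective (strictlyInverseˡ⇒inverseˡ f invˡ , strictlyInverseʳ⇒inverseʳ f invʳ)

  image-⊆⇒⊆-image : StrictlyInverseˡ _≡_ f f⁻¹ → {F : Pred A 0ℓ} {G : Pred C 0ℓ} →
                    Image f⁻¹ G ⊆ F → G ⊆ Image f F
  image-⊆⇒⊆-image invˡ f⁻¹G⊆F {y} y∈G = f⁻¹ y , f⁻¹G⊆F (y , y∈G , refl) , invˡ y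

  ⊆-image⇒image-⊆ : StrictlyInverseʳ _≡_ f f⁻¹ → {F : Pred A 0ℓ} {G : Pred C 0ℓ} →
                    G ⊆ Image f F → Image f⁻¹ G ⊆ F
  ⊆-image⇒image-⊆ invʳ {F} G⊆fF (y , y∈G , refl) with G⊆fF y∈G
  ... | x , x∈F , refl = subst F (sym (invʳ x)) x∈F

module InverseHomomorphic {A C : Set} (f : A → C) (f⁻¹ : C → A)
         (invˡ : StrictlyInverseˡ _≡_ f f⁻¹) (invʳ : StrictlyInverseʳ _≡_ f f⁻¹) where
  open ≡-Reasoning

  homomorphic₀ : ∀ {c₁ c₂} → f c₁ ≡ c₂ → f⁻¹ c₂ ≡ c₁
  homomorphic₀ {c₁} {c₂} hom = begin
    f⁻¹ c₂      ≡⟨ cong f⁻¹ hom ⟨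
    f⁻¹ (f c₁)  ≡⟨ invʳ c₁ ⟩
    c₁          ∎

  homomorphic₁ : ∀ {o₁ : Op₁ A} {o₂ : Op₁ C} →
                 (∀ x → f (o₁ x) ≡ o₂ (f x)) → ∀ y → f⁻¹ (o₂ y) ≡ o₁ (f⁻¹ y)
  homomorphic₁ {o₁} {o₂} hom y = begin
    f⁻¹ (o₂ y)            ≡⟨ cong (f⁻¹ ∘ o₂) (invˡ y) ⟨
    f⁻¹ (o₂ (f (f⁻¹ y)))  ≡⟨ cong f⁻¹ (hom (f⁻¹ y)) ⟨
    f⁻¹ (f (o₁ (f⁻¹ y)))  ≡⟨ invʳ (o₁ (f⁻¹ y)) ⟩
    o₁ (f⁻¹ y)            ∎

  homomorphic₂ : ∀ {_∙_ : Op₂ A} {_∘_ : Op₂ C} →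
                 (∀ x x′ → f (x ∙ x′) ≡ f x ∘ f x′) →
                 ∀ y y′ → f⁻¹ (y ∘ y′) ≡ f⁻¹ y ∙ f⁻¹ y′
  homomorphic₂ {_∙_} {_∘_} hom y y′ = begin
    f⁻¹ (y ∘ y′)                    ≡⟨ cong₂ (λ u v → f⁻¹ (u ∘ v)) (invˡ y) (invˡ y′) ⟨
    f⁻¹ (f (f⁻¹ y) ∘ f (f⁻¹ y′))    ≡⟨ cong f⁻¹ (hom (f⁻¹ y) (f⁻¹ y′)) ⟨
    f⁻¹ (f (f⁻¹ y ∙ f⁻¹ y′))        ≡⟨ invʳ (f⁻¹ y ∙ f⁻¹ y′) ⟩
    f⁻¹ y ∙ f⁻¹ y′                  ∎

module _ {B₁ B₂ : BooleanAlgebra} {h : BooleanAlgebra.Carrier B₁ → BooleanAlgebra.Carrier B₂}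
         {h⁻¹ : BooleanAlgebra.Carrier B₂ → BooleanAlgebra.Carrier B₁}
         (invˡ : StrictlyInverseˡ _≡_ h h⁻¹) (invʳ : StrictlyInverseʳ _≡_ h h⁻¹) where

  inverse-isBAHom : IsBAHom B₁ B₂ h → IsBAHom B₂ B₁ h⁻¹
  inverse-isBAHom hom = record
    { ∨-hom   = homomorphic₂ ∨-hom
    ; ∧-hom   = homomorphic₂ ∧-hom
    ; ¬-hom   = homomorphic₁ ¬-hom
    ; top-hom = homomorphic₀ top-hom
    ; bot-hom = homomorphic₀ bot-hom
    }
    where open IsBAHom hom
          open InverseHomomorphic h h⁻¹ invˡ invʳ

module _ {D₁ D₂ : ResiduatedLattice} {k : ResiduatedLattice.Carrier D₁ → ResiduatedLattice.Carrier D₂}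
         {k⁻¹ : ResiduatedLattice.Carrier D₂ → ResiduatedLattice.Carrier D₁}
         (invˡ : StrictlyInverseˡ _≡_ k k⁻¹) (invʳ : StrictlyInverseʳ _≡_ k k⁻¹) where

  inverse-isRLHom : IsRLHom D₁ D₂ k → IsRLHom D₂ D₁ k⁻¹
  inverse-isRLHom hom = record
    { *-hom   = homomorphic₂ *-hom
    ; ⇒-hom   = homomorphic₂ ⇒-hom
    ; ∨-hom   = homomorphic₂ ∨-hom
    ; ∧-hom   = homomorphic₂ ∧-hom
    ; top-hom = homomorphic₀ top-hom
    }
    where open IsRLHom hom
          open InverseHomomorphic k k⁻¹ invˡ invʳ

module _ {X Y : TObj} where
  private
    module X = TObj X
    module Y = TObj Y

  MapsFiltersOnto : TMor X Y → Set
  MapsFiltersOnto f = ∀ a → Image (TMor.k f) (proj₁ (X.φ a)) ≐ proj₁ (Y.φ (TMor.h f a))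

  isTIso⇒mapsFiltersOnto : (f : TMor X Y) → IsTIso f → MapsFiltersOnto f
  isTIso⇒mapsFiltersOnto f (g , (hgf , _) , (_ , kfg)) a =
    compat f a ,
    image-⊆⇒⊆-image kfg (subst (λ a′ → Image (k g) (proj₁ (Y.φ (h f a))) ⊆ proj₁ (X.φ a′))
                               (hgf a) (compat g (h f a)))
    where open TMor

  isoComponents⇒isTIso : (f : TMor X Y) →
                         IsBAIso X.B Y.B (TMor.h f) → IsRLIso X.D Y.D (TMor.k f) →
                         MapsFiltersOnto f → IsTIso f
  isoComponents⇒isTIso f h-iso k-iso onto =
    f⁻¹ , (H.strictlyInverseʳ , K.strictlyInverseʳ) , (H.strictlyInverseˡ , K.strictlyInverseˡ)
    where
    module H = Inverse (⤖⇒↔ (mk⤖ (IsBAIso.bijective h-iso)))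
    module K = Inverse (⤖⇒↔ (mk⤖ (IsRLIso.bijective k-iso)))

    φ₂⊆k[φ₁∘h⁻¹] : ∀ b → proj₁ (Y.φ b) ⊆ Image (TMor.k f) (proj₁ (X.φ (H.from b)))
    φ₂⊆k[φ₁∘h⁻¹] b = subst (λ b′ → proj₁ (Y.φ b′) ⊆ Image (TMor.k f) (proj₁ (X.φ (H.from b))))
                           (H.strictlyInverseˡ b) (proj₂ (onto (H.from b)))

    f⁻¹ : TMor Y X
    f⁻¹ = record
      { h      = H.from
      ; k      = K.from
      ; h-hom  = inverse-isBAHom H.strictlyInverseˡ H.strictlyInverseʳ (IsBAIso.isHom h-iso)
      ; k-hom  = inverse-isRLHom K.strictlyInverseˡ K.strictlyInverseʳ (IsRLIso.isHom k-iso)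
      ; compat = λ b → ⊆-image⇒image-⊆ K.strictlyInverseʳ (φ₂⊆k[φ₁∘h⁻¹] b)
      }

lemma3p6 : ∀ {X Y : TObj} (f : TMor X Y) →
    IsTIso f ⇔
      (IsBAIso (TObj.B X) (TObj.B Y) (TMor.h f) ×
       IsRLIso (TObj.D X) (TObj.D Y) (TMor.k f) ×
       (∀ a → Image (TMor.k f) (proj₁ (TObj.φ X a)) ≐ proj₁ (TObj.φ Y (TMor.h f a))))
lemma3p6 f = mk⇔
  (λ f-iso@(g , (hgf , kgf) , (hfg , kfg)) →
     record { isHom = TMor.h-hom f ; bijective = strictlyInverse⇒bijective hfg hgf } ,
     record { isHom = TMor.k-hom f ; bijective = strictlyInverse⇒bijective kfg kgf } ,
     isTIso⇒mapsFiltersOnto f f-iso)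
  (λ (h-iso , k-iso , onto) → isoComponents⇒isTIso f h-iso k-iso onto)
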